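{- Let $\mathbf G$ be a coherent canonical system. Then $\mathbf G$ is strongly decidable: given a finite set $\mathcal S$ of sequents and a sequent $s$, it is decidable whether $\mathcal{S}\vdash^{seq}_{\mathbf G}s$.
   Context: $\mathcal{L}$ is a propositional language with atoms $p_1,p_2,\ldots$ and set of formulas $\mathcal{F}$. A sequent is $\Gamma\Rightarrow E$ with $\Gamma$ a finite set of formulas and $E$ a set of formulas with at most one element. A clause is a sequent of atoms. An $\mathcal{L}$-substitution is a map $\sigma:\mathcal{F}\to\mathcal{F}$ commuting with all connectives, extended pointwise to sets. A canonical right-introduction rule for an $n$-ary connective $\diamond$ is $\{\Pi_i\Rightarrow E_i\}_{1\le i\le m}/\ \Rightarrow\diamond(p_1,\dots,p_n)$ with $m\ge0$ and $\Pi_i\cup E_i\subseteq\{p_1,\dots,p_n\}$; an application infers $\Gamma\Rightarrow\sigma(\diamond(p_1,\dots,p_n))$ from $\Gamma,\sigma(\Pi_i)\Rightarrow\sigma(E_i)$ ($1\le i\le m$), for any finite $\Gamma$ and substitution $\sigma$. A canonical left-introduction rule is $\langle\{\Pi_i\Rightarrow E_i\}_{1\le i\le m},\{\Sigma_j\Rightarrow\}_{1\le j\le k}\rangle/\ \diamond(p_1,\dots,p_n)\Rightarrow$ with all atoms among $p_1,\dots,p_n$; an application infers $\Gamma,\sigma(\diamond(p_1,\dots,p_n))\Rightarrow E$ from $\Gamma,\sigma(\Pi_i)\Rightarrow\sigma(E_i)$ and $\Gamma,\sigma(\Sigma_j)\Rightarrow E$, for any sequent $\Gamma\Rightarrow E$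 and substitution $\sigma$. A canonical system has axioms $\varphi\Rightarrow\varphi$, weakening (from $\Gamma\Rightarrow E$ infer $\Gamma,\Delta\Rightarrow E$; from $\Gamma\Rightarrow$ infer $\Gamma\Rightarrow\psi$), cut (from $\Gamma\Rightarrow\varphi$ and $\Delta,\varphi\Rightarrow E$ infer $\Gamma,\Delta\Rightarrow E$), and a set of canonical right- and left-introduction rules. $\mathcal{S}\vdash^{seq}_{\mathbf G}s$ means $s$ is derivable in $\mathbf G$ from the sequents of $\mathcal S$ as extra axioms. A classical assignment $u$ satisfies a clause $\Pi\Rightarrow E$ iff $u(p)=f$ for some $p\in\Pi$ or $E=\{q\}$ with $u(q)=t$; $\mathbf G$ is coherent iff for every connective $\diamond$, whenever $\mathbf G$ contains a left rule $\langle S_1,S_2\rangle/\diamond(p_1,\dots,p_n)\Rightarrow$ and a right rule $S_3/\Rightarrow\diamond(p_1,\dots,p_n)$, no assignment satisfies all clauses of $S_1\cup S_2\cup S_3$. -}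

module Defs where

open import Data.Nat using (ℕ)
open import Data.Fin using (Fin; toℕ)
open import Data.Bool using (Bool; true; false)
open import Data.Vec using (Vec; []; _∷_; tabulate)
open import Data.List using (List; _++_; map)
open import Data.List.Membership.Propositional using (_∈_)
open import Data.List.Relation.Unary.All using (All)
open import Data.List.Relation.Unary.Any using (Any)
open import Data.Maybe using (Maybe; just; nothing)
import Data.Maybe as Maybe
open import Data.Product using (_×_; _,_; Σ; proj₁; proj₂)
open import Relation.Binary.PropositionalEquality using (_≡_)
open import Relation.Binary.Definitions using (DecidableEquality)
open import Relation.Nullary using (¬_)
open import Function.Bundles using (_⇔_)

record Language : Set₁ where
  field
    Conn   : Set
    arity  : Conn → ℕ
    _≟C_   : DecidableEquality Conn

module _ (L : Language) where
  open Language L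

  data Formula : Set where
    atom : ℕ → Formula
    app  : (c : Conn) → Vec Formula (arity c) → Formula

  Substitution : Set
  Substitution = ℕ → Formula

  mutual
    subst : Substitution → Formula → Formula
    subst σ (atom n)  = σ n
    subst σ (app c φs) = app c (substV σ φs)

    substV : ∀ {n} → Substitution → Vec Formula n → Vec Formula n
    substV σ []       = []
    substV σ (φ ∷ φs) = subst σ φ ∷ substV σ φs

  -- Sequents Γ ⇒ E: Γ a finite set (represented by a list, read up to
  -- set-equality), E at most one formula.
  record Sequent : Set where
    constructor _⇒_
    field
      ante : List Formula
      succ : Maybe Formula

  _≈set_ : List Formula → List Formula → Set
  Γ ≈set Δ = ∀ φ → (φ ∈ Γ) ⇔ (φ ∈ Δ)

  -- Clauses over the atoms p_{i}, i < n (the atoms of the schema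
  -- ◇(p₁,…,pₙ)); atom i : Fin n denotes the atom p_{toℕ i}.
  Clause : ℕ → Set
  Clause n = List (Fin n) × Maybe (Fin n)

  pAtom : ∀ {n} → Fin n → Formula
  pAtom i = atom (toℕ i)

  schema : Conn → Formula
  schema c = app c (tabulate pAtom)

  record RightRule : Set where
    field
      conn     : Conn
      premises : List (Clause (arity conn))

  record LeftRule : Set where
    field
      conn  : Conn
      prem1 : List (Clause (arity conn))
      prem2 : List (List (Fin (arity conn)))

  -- A canonical system: axioms, weakening, cut, and a (finite) set of
  -- canonical right- and left-introduction rules.
  record CanonicalSystem : Set where
    field
      rightRules : List RightRule
      leftRules  : List LeftRule

  inst : ∀ {n} → Substitution → List (Fin n) → List Formula
  inst σ Π = map (λ i → subst σ (pAtom i)) Π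

  instE : ∀ {n} → Substitution → Maybe (Fin n) → Maybe Formula
  instE σ E = Maybe.map (λ i → subst σ (pAtom i)) E

  data Derivable (G : CanonicalSystem) (S : List Sequent) : Sequent → Set where
    hyp    : ∀ {s} → s ∈ S → Derivable G S s
    ax     : ∀ φ → Derivable G S ((φ Data.List.∷ Data.List.[]) ⇒ just φ)
    -- antecedents are sets: identify set-equal lists
    setEq  : ∀ {Γ Δ E} → Γ ≈set Δ → Derivable G S (Γ ⇒ E) → Derivable G S (Δ ⇒ E)
    weakL  : ∀ {Γ E} Δ → Derivable G S (Γ ⇒ E) → Derivable G S ((Γ ++ Δ) ⇒ E)
    weakR  : ∀ {Γ} ψ → Derivable G S (Γ ⇒ nothing) → Derivable G S (Γ ⇒ just ψ)
    cut    : ∀ {Γ Δ E φ} → Derivable G S (Γ ⇒ just φ) →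
             Derivable G S ((φ Data.List.∷ Δ) ⇒ E) → Derivable G S ((Γ ++ Δ) ⇒ E)
    rightI : ∀ (r : RightRule) → r ∈ CanonicalSystem.rightRules G →
             ∀ (Γ : List Formula) (σ : Substitution) →
             (∀ {c} → c ∈ RightRule.premises r →
                Derivable G S ((Γ ++ inst σ (proj₁ c)) ⇒ instE σ (proj₂ c))) →
             Derivable G S (Γ ⇒ just (subst σ (schema (RightRule.conn r))))
    leftI  : ∀ (r : LeftRule) → r ∈ CanonicalSystem.leftRules G →
             ∀ (Γ : List Formula) (E : Maybe Formula) (σ : Substitution) →
             (∀ {c} → c ∈ LeftRule.prem1 r →
                Derivable G S ((Γ ++ inst σ (proj₁ c)) ⇒ instE σ (proj₂ c))) →
             (∀ {Σ′} → Σ′ ∈ LeftRule.prem2 r →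
                Derivable G S ((Γ ++ inst σ Σ′) ⇒ E)) →
             Derivable G S ((subst σ (schema (LeftRule.conn r)) Data.List.∷ Γ) ⇒ E)

  Assignment : Set
  Assignment = ℕ → Bool

  satisfies : ∀ {n} → Assignment → Clause n → Set
  satisfies u (Π , E) =
    Any (λ p → u (toℕ p) ≡ false) Π
    ⊎′ (Σ (Fin _) λ q → (E ≡ just q) × (u (toℕ q) ≡ true))
    where open import Data.Sum renaming (_⊎_ to _⊎′_)

  satisfiesNeg : ∀ {n} → Assignment → List (Fin n) → Set
  satisfiesNeg u Σ′ = satisfies u (Σ′ , nothing)

  Coherent : CanonicalSystem → Set
  Coherent G =
    ∀ (l : LeftRule) → l ∈ CanonicalSystem.leftRules G →
    ∀ (r : RightRule) → r ∈ CanonicalSystem.rightRules G →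
    LeftRule.conn l ≡ RightRule.conn r →
    ¬ (Σ Assignment λ u →
         All (satisfies u) (LeftRule.prem1 l)
       × All (satisfiesNeg u) (LeftRule.prem2 l)
       × All (satisfies u) (RightRule.premises r))

  StronglyDecidable : CanonicalSystem → Set
  StronglyDecidable G =
    ∀ (S : List Sequent) (s : Sequent) → Dec (Derivable G S s)
    where open import Relation.Nullary using (Dec)

module Submission where

-- Let F be the subformulas of s and of the sequents in S.  Only finitely many sequents are built
-- from F, and those having a derivation all of whose formulas (cut formulas included) lie in F are
-- computed as a least fixed point.  If s is not among them, its antecedent is saturated to a set w
-- of F-formulas that does not prove its succedent in this restricted sense, but does so once any
-- further F-formula is added.  Saturated sets ordered by inclusion are the worlds of a Kripke
-- model: an F-formula holds at w iff it belongs to w, and ◇(φ₁,…,φₙ) outside F holds iff some right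
-- rule for ◇ has its premises satisfied at every world above w.  Every sequent derivable from S,
-- with unrestricted cuts, is valid in this model (for left rules on formulas outside F this is
-- exactly what coherence of G provides), while s fails at w.

open import Defs
open import Data.Bool using (Bool; true; false; T; _∨_)
open import Data.Bool.Properties using (T-∨; ¬-not) renaming (_≟_ to _≟ᵇ_)
open import Data.Empty using (⊥; ⊥-elim)
open import Data.Fin using (Fin; zero; suc; toℕ)
import Data.Fin.Properties as Fin
open import Data.Fin.Properties using (any?; all?)
open import Data.Fin.Subset using (Subset; ⁅_⁆; _∪_) renaming (_∈_ to _∈ₛ_; _⊆_ to _⊆ₛ_)
open import Data.Fin.Subset.Properties
  using (anySubset?; x∈⁅x⁆; x∈p∪q⁺; x∈p∪q⁻; x∈⁅y⁆⇒x≡y; p⊆p∪q; q⊆p∪q)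
  renaming (_∈?_ to _∈ₛ?_; _⊆?_ to _⊆ₛ?_)
open import Data.List
  using (List; []; _∷_; _++_; map; filter; length; allFin; concatMap; fromMaybe;
         cartesianProduct; cartesianProductWith)
import Data.List as List
import Data.List.Properties as Listₚ
open import Data.List.Membership.Propositional using (_∈_; find; lose)
open import Data.List.Membership.Propositional.Properties
  using (∈-++⁺ˡ; ∈-++⁺ʳ; ∈-++⁻; ∈-map⁺; ∈-map⁻; ∈-filter⁺; ∈-filter⁻; ∈-allFin; ∈-concatMap⁺;
         ∈-concatMap⁻; ∈-cartesianProduct⁺; ∈-cartesianProductWith⁺)
open import Data.List.Relation.Binary.Subset.Propositional using (_⊆_)
open import Data.List.Relation.Unary.All as All using (All; []; _∷_)
open import Data.List.Relation.Unary.All.Properties using (¬All⇒Any¬; ++⁺; ++⁻ˡ; ++⁻ʳ)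
open import Data.List.Relation.Unary.Any as Any using (Any; here; there)
open import Data.List.Relation.Unary.Any.Properties using (lookup-index; map⁻)
open import Data.Maybe using (Maybe; just; nothing; Is-just)
import Data.Maybe as Maybe
import Data.Maybe.Properties as Maybeₚ
open import Data.Maybe.Relation.Unary.All as Allᴹ using () renaming (All to Allᴹ)
open import Data.Maybe.Relation.Unary.Any as Anyᴹ using () renaming (Any to Anyᴹ)
open import Data.Nat using (ℕ; zero; suc; _≤_; _<_; z≤n; s≤s)
import Data.Nat as ℕ
open import Data.Nat.Properties using (≤-trans; <-irrefl; m≤n⇒m≤1+n; ≤-<-trans)
open import Data.Product using (Σ; ∃; ∃-syntax; _×_; _,_; proj₁; proj₂)
open import Data.Sum using (_⊎_; inj₁; inj₂; [_,_]′)
import Data.Sum as Sum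
open import Data.Unit using (tt)
open import Data.Vec using (Vec; []; _∷_; lookup; tabulate)
open import Data.Vec.Properties using (tabulate-cong; lookup∘tabulate; lookup⇒[]=; []=⇒lookup)
open import Function using (_∘_; id)
open import Function.Bundles using (Equivalence; mk⇔)
open import Relation.Binary.Definitions using (DecidableEquality)
open import Relation.Binary.PropositionalEquality
  using (_≡_; refl; sym; trans; cong) renaming (subst to transport)
open import Relation.Nullary using (Dec; yes; no; ¬_; does)
open import Relation.Nullary.Decidable
  using (⌊_⌋; toWitness; fromWitness; dec-true; map′; ¬?; _×-dec_; _⊎-dec_; _→-dec_)
open import Relation.Nullary.Decidable.Core using (T?)

lookupOr : ∀ {A : Set} {n} → A → Vec A n → ℕ → A
lookupOr d []       m       = d
lookupOr d (x ∷ xs) zero    = x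
lookupOr d (x ∷ xs) (suc m) = lookupOr d xs m

lookupOr-toℕ : ∀ {A : Set} {n} (d : A) (xs : Vec A n) (i : Fin n) → lookupOr d xs (toℕ i) ≡ lookup xs i
lookupOr-toℕ d (x ∷ xs) zero    = refl
lookupOr-toℕ d (x ∷ xs) (suc i) = lookupOr-toℕ d xs i

_≗[_]_ : ∀ {A : Set} → (ℕ → A) → ℕ → (ℕ → A) → Set
f ≗[ n ] g = ∀ (i : Fin n) → f (toℕ i) ≡ g (toℕ i)

does≡true⇒ : ∀ {P : Set} (d : Dec P) → does d ≡ true → P
does≡true⇒ (yes p) _ = p

true≢false : ∀ {b} → b ≡ true → ¬ b ≡ false
true≢false refl ()

∀-enumerable? : ∀ {A : Set} {P : A → Set} (xs : List A) → (∀ x → x ∈ xs) →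
                (∀ x → Dec (P x)) → Dec (∀ x → P x)
∀-enumerable? xs complete P? =
  map′ (λ all x → All.lookup all (complete x)) (λ all → All.tabulate λ {x} _ → all x) (All.all? P? xs)

∃-enumerable? : ∀ {A : Set} {P : A → Set} (xs : List A) → (∀ x → x ∈ xs) →
                (∀ x → Dec (P x)) → Dec (∃ P)
∃-enumerable? xs complete P? =
  map′ (λ any → let x , _ , px = find any in x , px) (λ (x , px) → lose (complete x) px) (Any.any? P? xs)

subsets : ∀ n → List (Subset n)
subsets zero    = [] ∷ []
subsets (suc n) = cartesianProductWith _∷_ (true ∷ false ∷ []) (subsets n)

∈-subsets : ∀ {n} (p : Subset n) → p ∈ subsets n
∈-subsets []          = here refl
∈-subsets (true ∷ p)  = ∈-cartesianProductWith⁺ _∷_ {xs = true ∷ false ∷ []} (here refl) (∈-subsets p)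
∈-subsets (false ∷ p) = ∈-cartesianProductWith⁺ _∷_ {xs = true ∷ false ∷ []} (there (here refl)) (∈-subsets p)

optionsOf : ∀ {A : Set} → List A → List (Maybe A)
optionsOf xs = nothing ∷ map just xs

∈-optionsOf : ∀ {A : Set} {xs : List A} → (∀ x → x ∈ xs) → ∀ e → e ∈ optionsOf xs
∈-optionsOf complete nothing  = here refl
∈-optionsOf complete (just x) = there (∈-map⁺ just (complete x))

module LeastFixedPoint {U : Set} (univ : List U) (univ-complete : ∀ u → u ∈ univ)
                       (Rule : (U → Bool) → U → Set) (Rule? : ∀ X u → Dec (Rule X u)) where

  private
    stage : ℕ → U → Bool
    stage zero    u = false
    stage (suc n) u = stage n u ∨ ⌊ Rule? (stage n) u ⌋

    stage-mono : ∀ n {u} → T (stage n u) → T (stage (suc n) u)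
    stage-mono n = Equivalence.from T-∨ ∘ inj₁

    Stable : ℕ → Set
    Stable n = All (λ u → T (stage (suc n) u) → T (stage n u)) univ

    stable? : ∀ n → Dec (Stable n)
    stable? n = All.all? (λ u → T? _ →-dec T? _) univ

    ∣_∣ : (U → Bool) → List U → ℕ
    ∣ X ∣ []       = 0
    ∣ X ∣ (u ∷ us) with X u
    ... | true  = suc (∣ X ∣ us)
    ... | false = ∣ X ∣ us

    ∣∣≤length : ∀ X us → ∣ X ∣ us ≤ length us
    ∣∣≤length X []       = z≤n
    ∣∣≤length X (u ∷ us) with X u
    ... | true  = s≤s (∣∣≤length X us)
    ... | false = m≤n⇒m≤1+n (∣∣≤length X us)

    ∣∣-mono : ∀ {X Y} → (∀ {u} → T (X u) → T (Y u)) → ∀ us → ∣ X ∣ us ≤ ∣ Y ∣ us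
    ∣∣-mono X⊆Y []       = z≤n
    ∣∣-mono {X} {Y} X⊆Y (u ∷ us) with X u | Y u | X⊆Y {u}
    ... | true  | true  | _   = s≤s (∣∣-mono X⊆Y us)
    ... | false | true  | _   = m≤n⇒m≤1+n (∣∣-mono X⊆Y us)
    ... | false | false | _   = ∣∣-mono X⊆Y us
    ... | true  | false | X→Y with () ← X→Y tt

    ∣∣-strict : ∀ {X Y} → (∀ {u} → T (X u) → T (Y u)) → ∀ {us} →
                Any (λ u → ¬ T (X u) × T (Y u)) us → ∣ X ∣ us < ∣ Y ∣ us
    ∣∣-strict {X} {Y} X⊆Y {u ∷ us} (here (¬Xu , Yu)) with X u | Y u
    ... | true  | _    = ⊥-elim (¬Xu tt)
    ... | false | true = s≤s (∣∣-mono X⊆Y us)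
    ∣∣-strict {X} {Y} X⊆Y {u ∷ us} (there p) with X u | Y u | X⊆Y {u}
    ... | true  | true  | _   = s≤s (∣∣-strict X⊆Y p)
    ... | false | true  | _   = m≤n⇒m≤1+n (∣∣-strict X⊆Y p)
    ... | false | false | _   = ∣∣-strict X⊆Y p
    ... | true  | false | X→Y with () ← X→Y tt

    ¬[T⇒T] : ∀ {a b} → ¬ (T b → T a) → ¬ T a × T b
    ¬[T⇒T] {true}          ¬b→a = ⊥-elim (¬b→a _)
    ¬[T⇒T] {false} {true}  ¬b→a = (λ ()) , tt
    ¬[T⇒T] {false} {false} ¬b→a = ⊥-elim (¬b→a (λ ()))

    stable-or-large : ∀ n → Σ ℕ Stable ⊎ n ≤ ∣ stage n ∣ univ
    stable-or-large zero = inj₂ z≤n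
    stable-or-large (suc n) with stable-or-large n | stable? n
    ... | inj₁ stable | _      = inj₁ stable
    ... | inj₂ _      | yes st = inj₁ (n , st)
    ... | inj₂ large  | no ¬st = inj₂ (≤-<-trans large (∣∣-strict (stage-mono n) new-element))
      where new-element = Any.map ¬[T⇒T] (¬All⇒Any¬ (λ u → T? _ →-dec T? _) univ ¬st)

    stabilisation : Σ ℕ Stable
    stabilisation with stable-or-large (suc (length univ))
    ... | inj₁ stable = stable
    ... | inj₂ large  = ⊥-elim (<-irrefl refl (≤-trans large (∣∣≤length _ univ)))

  -- abstract, so that type checking never runs the fixed-point computation
  abstract
    μ : U → Bool
    μ = stage (proj₁ stabilisation)

    μ-closed : ∀ {u} → Rule μ u → T (μ u)
    μ-closed {u} r = All.lookup (proj₂ stabilisation) (univ-complete u)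
                       (Equivalence.from (T-∨ {μ u}) (inj₂ (fromWitness r)))

    μ-induction : (P : U → Set) → (∀ {X u} → (∀ {v} → T (X v) → P v) → Rule X u → P u) →
                  ∀ {u} → T (μ u) → P u
    μ-induction P step = go (proj₁ stabilisation)
      where
        go : ∀ n {u} → T (stage n u) → P u
        go (suc n) {u} s with Equivalence.to T-∨ s
        ... | inj₁ earlier = go n earlier
        ... | inj₂ fired   = step (go n) (toWitness fired)


module Syntax (L : Language) where
  open Language L

  mutual
    _≟_ : DecidableEquality (Formula L)
    atom n ≟ atom m with n ℕ.≟ m
    ... | yes refl = yes refl
    ... | no n≢m   = no λ { refl → n≢m refl }
    atom _ ≟ app _ _ = no λ ()
    app _ _ ≟ atom _ = no λ ()
    app c φs ≟ app d ψs with c ≟C d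
    ... | no c≢d   = no λ { refl → c≢d refl }
    ... | yes refl with φs ≟ⁿ ψs
    ...   | yes refl = yes refl
    ...   | no φs≢ψs = no λ { refl → φs≢ψs refl }

    _≟ⁿ_ : ∀ {n} → DecidableEquality (Vec (Formula L) n)
    [] ≟ⁿ [] = yes refl
    (φ ∷ φs) ≟ⁿ (ψ ∷ ψs) with φ ≟ ψ | φs ≟ⁿ ψs
    ... | yes refl | yes refl = yes refl
    ... | no φ≢ψ   | _        = no λ { refl → φ≢ψ refl }
    ... | _        | no φs≢ψs = no λ { refl → φs≢ψs refl }

  substV-tabulate : ∀ {n} (σ : Substitution L) (f : Fin n → Formula L) →
                    substV L σ (tabulate f) ≡ tabulate (subst L σ ∘ f)
  substV-tabulate {zero}  σ f = refl
  substV-tabulate {suc n} σ f = cong (subst L σ (f zero) ∷_) (substV-tabulate σ (f ∘ suc))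

  subst-schema : ∀ (σ : Substitution L) c → subst L σ (schema L c) ≡ app c (tabulate (σ ∘ toℕ))
  subst-schema σ c = cong (app c) (substV-tabulate σ (pAtom L))

  subst-schema-cong : ∀ {σ τ : Substitution L} c → σ ≗[ arity c ] τ →
                      subst L σ (schema L c) ≡ subst L τ (schema L c)
  subst-schema-cong {σ} {τ} c σ≗τ =
    trans (subst-schema σ c) (trans (cong (app c) (tabulate-cong σ≗τ)) (sym (subst-schema τ c)))

  -- subst σ (schema c) reduces to app c (arguments σ)
  arguments : ∀ {n} → Substitution L → Vec (Formula L) n
  arguments σ = substV L σ (tabulate (pAtom L))

  lookup-arguments : ∀ {n} (σ : Substitution L) (i : Fin n) →
                     lookup (arguments σ) i ≡ σ (toℕ i)
  lookup-arguments σ i =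
    trans (cong (λ φs → lookup φs i) (substV-tabulate σ (pAtom L))) (lookup∘tabulate (σ ∘ toℕ) i)

  matchingSubst : Formula L → Substitution L
  matchingSubst (atom _)   m = atom m
  matchingSubst (app c φs) m = lookupOr (atom m) φs m

  matchingSubst-instance : ∀ (σ : Substitution L) c →
                           matchingSubst (subst L σ (schema L c)) ≗[ arity c ] σ
  matchingSubst-instance σ c i =
    trans (lookupOr-toℕ (atom (toℕ i)) (arguments σ) i) (lookup-arguments σ i)

  satisfies-cong : ∀ {n} {u v : Assignment L} → u ≗[ n ] v →
                   ∀ cl → satisfies L u cl → satisfies L v cl
  satisfies-cong u≗v (Π , E) (inj₁ falsified) = inj₁ (Any.map (λ {p} → trans (sym (u≗v p))) falsified)
  satisfies-cong u≗v (Π , E) (inj₂ (q , E≡q , uq≡t)) = inj₂ (q , E≡q , trans (sym (u≗v q)) uq≡t)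

  mutual
    subformulas : Formula L → List (Formula L)
    subformulas (atom n)   = atom n ∷ []
    subformulas (app c φs) = app c φs ∷ argumentSubformulas φs

    argumentSubformulas : ∀ {n} → Vec (Formula L) n → List (Formula L)
    argumentSubformulas []       = []
    argumentSubformulas (φ ∷ φs) = subformulas φ ++ argumentSubformulas φs

  ∈-subformulas : ∀ φ → φ ∈ subformulas φ
  ∈-subformulas (atom n)   = here refl
  ∈-subformulas (app c φs) = here refl

  ∈-argumentSubformulas : ∀ {n} (φs : Vec (Formula L) n) i →
                          lookup φs i ∈ argumentSubformulas φs
  ∈-argumentSubformulas (φ ∷ φs) zero    = ∈-++⁺ˡ (∈-subformulas φ)
  ∈-argumentSubformulas (φ ∷ φs) (suc i) = ∈-++⁺ʳ (subformulas φ) (∈-argumentSubformulas φs i)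

  mutual
    subformulas-trans : ∀ χ {ψ φ} → ψ ∈ subformulas χ → φ ∈ subformulas ψ → φ ∈ subformulas χ
    subformulas-trans (atom n)   (here refl) φ∈ψ = φ∈ψ
    subformulas-trans (app c χs) (here refl) φ∈ψ = φ∈ψ
    subformulas-trans (app c χs) (there ψ∈χs) φ∈ψ = there (argumentSubformulas-trans χs ψ∈χs φ∈ψ)

    argumentSubformulas-trans : ∀ {n} (χs : Vec (Formula L) n) {ψ φ} → ψ ∈ argumentSubformulas χs →
                                φ ∈ subformulas ψ → φ ∈ argumentSubformulas χs
    argumentSubformulas-trans (χ ∷ χs) ψ∈ φ∈ψ with ∈-++⁻ (subformulas χ) ψ∈
    ... | inj₁ ψ∈χ  = ∈-++⁺ˡ (subformulas-trans χ ψ∈χ φ∈ψ)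
    ... | inj₂ ψ∈χs = ∈-++⁺ʳ (subformulas χ) (argumentSubformulas-trans χs ψ∈χs φ∈ψ)

  SubformulaClosed : List (Formula L) → Set
  SubformulaClosed Φ = ∀ {c φs} → app c φs ∈ Φ → ∀ i → lookup φs i ∈ Φ

  subformulaClosure : List (Formula L) → List (Formula L)
  subformulaClosure = concatMap subformulas

  ⊆-subformulaClosure : ∀ Γ → Γ ⊆ subformulaClosure Γ
  ⊆-subformulaClosure Γ φ∈Γ =
    ∈-concatMap⁺ subformulas (Any.map (λ { refl → ∈-subformulas _ }) φ∈Γ)

  subformulaClosure-closed : ∀ Γ → SubformulaClosed (subformulaClosure Γ)
  subformulaClosure-closed Γ {φs = φs} app∈ i =
    ∈-concatMap⁺ subformulas
      (Any.map (λ {χ} app∈χ → subformulas-trans χ app∈χ (there (∈-argumentSubformulas φs i)))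
               (∈-concatMap⁻ subformulas {xs = Γ} app∈))

  satisfies? : ∀ {n} (u : Assignment L) (cl : Clause L n) → Dec (satisfies L u cl)
  satisfies? u (Π , E) =
          Any.any? (λ p → u (toℕ p) ≟ᵇ false) Π
    ⊎-dec any? (λ q → Maybeₚ.≡-dec Fin._≟_ E (just q) ×-dec (u (toℕ q) ≟ᵇ true))

  SequentOver : List (Formula L) → Sequent L → Set
  SequentOver Φ (Γ ⇒ E) = Γ ⊆ Φ × Allᴹ (_∈ Φ) E

  sequentFormulas : Sequent L → List (Formula L)
  sequentFormulas (Γ ⇒ E) = fromMaybe E ++ Γ

  sequentOver : ∀ {Φ} s → sequentFormulas s ⊆ Φ → SequentOver Φ s
  sequentOver (Γ ⇒ nothing) ⊆Φ = ⊆Φ , Allᴹ.nothing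
  sequentOver (Γ ⇒ just ψ)  ⊆Φ = ⊆Φ ∘ there , Allᴹ.just (⊆Φ (here refl))

  sequentOver-closure : ∀ {s ss} → s ∈ ss →
                        SequentOver (subformulaClosure (concatMap sequentFormulas ss)) s
  sequentOver-closure {s} {ss} s∈ss = sequentOver s λ φ∈ →
    ⊆-subformulaClosure (concatMap sequentFormulas ss) (∈-concatMap⁺ sequentFormulas (lose s∈ss φ∈))


module AnalyticCalculus (L : Language) (G : CanonicalSystem L) (S : List (Sequent L))
                        (F : List (Formula L)) where
  open Language L
  open CanonicalSystem G
  open Syntax L
  open import Data.List.Membership.DecPropositional _≟_ using (_∈?_)
  open import Data.List.Relation.Binary.Subset.DecPropositional _≟_ using (_⊆?_)

  Index : Set
  Index = Fin (length F)

  at : Index → Formula L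
  at = List.lookup F

  Antecedent : Set
  Antecedent = Subset (length F)

  -- A code (Γ , E) stands for the sequent formulas Γ ⇒ decodeSucc E over F.  Positions in F
  -- rather than formulas make the codes finitely many; F may contain repetitions.
  Code : Set
  Code = Antecedent × Maybe Index

  formulas : Antecedent → List (Formula L)
  formulas Γ = map at (filter (_∈ₛ? Γ) (allFin _))

  ∈-formulas⁺ : ∀ {Γ i} → i ∈ₛ Γ → at i ∈ formulas Γ
  ∈-formulas⁺ {Γ} {i} i∈Γ = ∈-map⁺ at (∈-filter⁺ (_∈ₛ? Γ) (∈-allFin i) i∈Γ)

  ∈-formulas⁻ : ∀ {Γ φ} → φ ∈ formulas Γ → ∃[ i ] i ∈ₛ Γ × φ ≡ at i
  ∈-formulas⁻ {Γ} φ∈ with ∈-map⁻ at φ∈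
  ... | i , i∈ , refl = i , proj₂ (∈-filter⁻ (_∈ₛ? Γ) {xs = allFin _} i∈) , refl

  formulas-mono : ∀ {Γ Δ} → Γ ⊆ₛ Δ → formulas Γ ⊆ formulas Δ
  formulas-mono Γ⊆Δ φ∈ with ∈-formulas⁻ φ∈
  ... | i , i∈Γ , refl = ∈-formulas⁺ (Γ⊆Δ i∈Γ)

  indices : List (Formula L) → Antecedent
  indices Δ = tabulate (λ i → does (at i ∈? Δ))

  ∈-indices⁺ : ∀ {Δ i} → at i ∈ Δ → i ∈ₛ indices Δ
  ∈-indices⁺ {Δ} {i} m = lookup⇒[]= i _ (trans (lookup∘tabulate _ i) (dec-true (at i ∈? Δ) m))

  ∈-indices⁻ : ∀ {Δ i} → i ∈ₛ indices Δ → at i ∈ Δ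
  ∈-indices⁻ {Δ} {i} i∈
    with at i ∈? Δ | trans (sym (lookup∘tabulate (λ i → does (at i ∈? Δ)) i)) ([]=⇒lookup i∈)
  ... | yes m | _ = m
  ... | no _  | ()

  ∈-formulas-indices : ∀ {φ Δ Γ} → φ ∈ F → φ ∈ Δ → indices Δ ⊆ₛ Γ → φ ∈ formulas Γ
  ∈-formulas-indices {φ} {Δ} {Γ} φ∈F φ∈Δ Δ⊆Γ =
    transport (_∈ formulas Γ) (sym φ≡) (∈-formulas⁺ (Δ⊆Γ (∈-indices⁺ (transport (_∈ Δ) φ≡ φ∈Δ))))
    where φ≡ = lookup-index φ∈F

  formulas-indices : ∀ Δ → formulas (indices Δ) ⊆ Δ
  formulas-indices Δ φ∈ with ∈-formulas⁻ φ∈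
  ... | i , i∈ , refl = ∈-indices⁻ i∈

  adjoin : Antecedent → List (Formula L) → Antecedent
  adjoin Γ Δ = Γ ∪ indices Δ

  ⊆-adjoin : ∀ Γ Δ → Γ ⊆ₛ adjoin Γ Δ
  ⊆-adjoin Γ Δ = p⊆p∪q (indices Δ)

  ∈-adjoin : ∀ Γ {Δ i} → at i ∈ Δ → i ∈ₛ adjoin Γ Δ
  ∈-adjoin Γ m = x∈p∪q⁺ (inj₂ (∈-indices⁺ m))

  insert-⊆-adjoin : ∀ {i Δ} Γ → at i ∈ Δ → ⁅ i ⁆ ∪ Γ ⊆ₛ adjoin Γ Δ
  insert-⊆-adjoin {i} {Δ} Γ i∈Δ x∈ with x∈p∪q⁻ ⁅ i ⁆ Γ x∈
  ... | inj₁ x∈⁅i⁆ rewrite x∈⁅y⁆⇒x≡y i x∈⁅i⁆ = ∈-adjoin Γ i∈Δ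
  ... | inj₂ x∈Γ   = ⊆-adjoin Γ Δ x∈Γ

  formulas-adjoin : ∀ Γ Δ → formulas (adjoin Γ Δ) ⊆ formulas Γ ++ Δ
  formulas-adjoin Γ Δ φ∈ with ∈-formulas⁻ φ∈
  ... | i , i∈ , refl with x∈p∪q⁻ Γ (indices Δ) i∈
  ...   | inj₁ i∈Γ = ∈-++⁺ˡ (∈-formulas⁺ i∈Γ)
  ...   | inj₂ i∈Δ = ∈-++⁺ʳ (formulas Γ) (∈-indices⁻ i∈Δ)

  formulas-insert : ∀ i Γ → formulas (⁅ i ⁆ ∪ Γ) ⊆ at i ∷ formulas Γ
  formulas-insert i Γ φ∈ with ∈-formulas⁻ φ∈
  ... | j , j∈ , refl with x∈p∪q⁻ ⁅ i ⁆ Γ j∈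
  ...   | inj₁ j∈⁅i⁆ rewrite x∈⁅y⁆⇒x≡y i j∈⁅i⁆ = here refl
  ...   | inj₂ j∈Γ = there (∈-formulas⁺ j∈Γ)

  insert-mono : ∀ (i : Index) {Γ Δ} → Γ ⊆ₛ Δ → ⁅ i ⁆ ∪ Γ ⊆ₛ ⁅ i ⁆ ∪ Δ
  insert-mono i {Γ} Γ⊆Δ j∈ = x∈p∪q⁺ (Sum.map₂ (λ j∈Γ → Γ⊆Δ j∈Γ) (x∈p∪q⁻ ⁅ i ⁆ Γ j∈))

  decodeSucc : Maybe Index → Maybe (Formula L)
  decodeSucc = Maybe.map at

  -- A formula outside F is sent to the empty succedent (junk value).
  encodeSucc : Maybe (Formula L) → Maybe Index
  encodeSucc nothing = nothing
  encodeSucc (just ψ) with ψ ∈? F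
  ... | yes ψ∈F = just (Any.index ψ∈F)
  ... | no _    = nothing

  encodeSucc-∈ : ∀ {ψ} → ψ ∈ F → ∃[ j ] encodeSucc (just ψ) ≡ just j × at j ≡ ψ
  encodeSucc-∈ {ψ} ψ∈F with ψ ∈? F
  ... | yes m  = Any.index m , refl , sym (lookup-index m)
  ... | no ψ∉F = ⊥-elim (ψ∉F ψ∈F)

  decodeSucc-encodeSucc : ∀ {E} → Allᴹ (_∈ F) E → decodeSucc (encodeSucc E) ≡ E
  decodeSucc-encodeSucc Allᴹ.nothing      = refl
  decodeSucc-encodeSucc (Allᴹ.just ψ∈F) with encodeSucc-∈ ψ∈F
  ... | j , eq , refl rewrite eq = refl

  infix 4 ⊢_
  ⊢_ : Sequent L → Set
  ⊢_ = Derivable L G S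

  weaken : ∀ {Γ Δ E} → ⊢ (Γ ⇒ E) → Γ ⊆ Δ → ⊢ (Δ ⇒ E)
  weaken {Γ} {Δ} ⊢Γ Γ⊆Δ =
    setEq (λ φ → mk⇔ ([ Γ⊆Δ , id ]′ ∘ ∈-++⁻ Γ) (∈-++⁺ʳ Γ)) (weakL Δ ⊢Γ)

  derivable-encodeSucc : ∀ {Δ} E → ⊢ (Δ ⇒ decodeSucc (encodeSucc E)) → ⊢ (Δ ⇒ E)
  derivable-encodeSucc nothing ⊢Δ = ⊢Δ
  derivable-encodeSucc {Δ} (just ψ) ⊢Δ with ψ ∈? F
  ... | yes m = transport (λ φ → ⊢ (Δ ⇒ just φ)) (sym (lookup-index m)) ⊢Δ
  ... | no _  = weakR ψ ⊢Δ

  Premise : ∀ {n} → (Code → Bool) → Antecedent → Substitution L → Clause L n → Set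
  Premise X Γ σ (Π , E) = T (X (adjoin Γ (inst L σ Π) , encodeSucc (instE L σ E)))

  -- The substitution of a rule instance is recovered from its principal formula, so Step is decidable.
  IsInstance : Index → Conn → Set
  IsInstance j c = at j ≡ subst L (matchingSubst (at j)) (schema L c)

  RightInstance : (Code → Bool) → Antecedent → Index → RightRule L → Set
  RightInstance X Γ j r =
    IsInstance j (RightRule.conn r) × All (Premise X Γ (matchingSubst (at j))) (RightRule.premises r)

  LeftInstance : (Code → Bool) → Code → Index → LeftRule L → Set
  LeftInstance X (Γ , E) i l =
      IsInstance i (LeftRule.conn l)
    × All (Premise X Γ σ) (LeftRule.prem1 l)
    × All (λ Σ′ → T (X (adjoin Γ (inst L σ Σ′) , E))) (LeftRule.prem2 l)
    where σ = matchingSubst (at i)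

  -- One disjunct per rule of G, restricted to sequents over F; X holds the codes already derived.
  Step : (Code → Bool) → Code → Set
  Step X (Γ , E) =
      Anyᴹ (λ j → at j ∈ formulas Γ) E
    ⊎ Any (λ s → Sequent.ante s ⊆ formulas Γ × Sequent.succ s ≡ decodeSucc E) S
    ⊎ (∃[ Δ ] Δ ⊆ₛ Γ × T (X (Δ , E)))
    ⊎ (Is-just E × T (X (Γ , nothing)))
    ⊎ (∃[ i ] T (X (Γ , just i)) × T (X (⁅ i ⁆ ∪ Γ , E)))
    ⊎ Anyᴹ (λ j → Any (RightInstance X Γ j) rightRules) E
    ⊎ (∃[ i ] i ∈ₛ Γ × Any (LeftInstance X (Γ , E) i) leftRules)

  pattern byAxiom j∈Γ        = inj₁ (Anyᴹ.just j∈Γ)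
  pattern byHypothesis s     = inj₂ (inj₁ s)
  pattern byWeakenL Δ Δ⊆Γ ⊢Δ = inj₂ (inj₂ (inj₁ (Δ , Δ⊆Γ , ⊢Δ)))
  pattern byWeakenR ⊢Γ       = inj₂ (inj₂ (inj₂ (inj₁ (Anyᴹ.just _ , ⊢Γ))))
  pattern byCut i ⊢i ⊢iΓ     = inj₂ (inj₂ (inj₂ (inj₂ (inj₁ (i , ⊢i , ⊢iΓ)))))
  pattern byIntroR r         = inj₂ (inj₂ (inj₂ (inj₂ (inj₂ (inj₁ (Anyᴹ.just r))))))
  pattern byIntroL i i∈Γ l   = inj₂ (inj₂ (inj₂ (inj₂ (inj₂ (inj₂ (i , i∈Γ , l))))))

  step? : ∀ X u → Dec (Step X u)
  step? X (Γ , E) =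
          Anyᴹ.dec (λ j → at j ∈? formulas Γ) E
    ⊎-dec Any.any? (λ s → (Sequent.ante s ⊆? formulas Γ)
                          ×-dec Maybeₚ.≡-dec _≟_ (Sequent.succ s) (decodeSucc E)) S
    ⊎-dec anySubset? (λ Δ → (Δ ⊆ₛ? Γ) ×-dec T? _)
    ⊎-dec (Anyᴹ.dec (λ _ → yes _) E ×-dec T? _)
    ⊎-dec any? (λ i → T? _ ×-dec T? _)
    ⊎-dec Anyᴹ.dec (λ j → Any.any? (λ r → (at j ≟ _) ×-dec All.all? (λ _ → T? _) _) rightRules) E
    ⊎-dec any? (λ i → (i ∈ₛ? Γ) ×-dec
                      Any.any? (λ l → (at i ≟ _) ×-dec All.all? (λ _ → T? _) _ ×-dec All.all? (λ _ → T? _) _)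
                               leftRules)

  codes : List Code
  codes = cartesianProduct (subsets _) (optionsOf (allFin _))

  ∈-codes : ∀ u → u ∈ codes
  ∈-codes (Γ , E) = ∈-cartesianProduct⁺ (∈-subsets Γ) (∈-optionsOf ∈-allFin E)

  open LeastFixedPoint codes ∈-codes Step step? public using (μ; μ-closed)
  open LeastFixedPoint codes ∈-codes Step step? using (μ-induction)

  Provable : Code → Set
  Provable u = T (μ u)

  provable? : ∀ u → Dec (Provable u)
  provable? u = T? (μ u)

  Sound : Code → Set
  Sound (Γ , E) = ⊢ (formulas Γ ⇒ decodeSucc E)

  module _ {X : Code → Bool} (ih : ∀ {v} → T (X v) → Sound v) where

    premise-sound : ∀ {n Γ} σ (cl : Clause L n) → Premise X Γ σ cl →
                    ⊢ ((formulas Γ ++ inst L σ (proj₁ cl)) ⇒ instE L σ (proj₂ cl))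
    premise-sound {Γ = Γ} σ (Π , E) p =
      derivable-encodeSucc (instE L σ E) (weaken (ih p) (formulas-adjoin Γ (inst L σ Π)))

    step-sound : ∀ {u} → Step X u → Sound u
    step-sound {Γ , just j} (byAxiom j∈Γ) = weaken (ax (at j)) λ { (here refl) → j∈Γ }
    step-sound (byHypothesis s) with find s
    ... | (Δ ⇒ E′) , s∈S , Δ⊆Γ , refl = weaken (hyp s∈S) Δ⊆Γ
    step-sound (byWeakenL Δ Δ⊆Γ ⊢Δ) = weaken (ih ⊢Δ) (formulas-mono Δ⊆Γ)
    step-sound (byWeakenR ⊢Γ) = weakR _ (ih ⊢Γ)
    step-sound {Γ , E} (byCut i ⊢i ⊢iΓ) =
      weaken (cut (ih ⊢i) (weaken (ih ⊢iΓ) (formulas-insert i Γ)))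
             ([ id , id ]′ ∘ ∈-++⁻ (formulas Γ))
    step-sound {Γ , just j} (byIntroR r) with find r
    ... | r , r∈ , j≡ , prems =
      transport (λ φ → ⊢ (formulas Γ ⇒ just φ)) (sym j≡)
        (rightI r r∈ (formulas Γ) σ (λ {cl} cl∈ → premise-sound σ cl (All.lookup prems cl∈)))
      where σ = matchingSubst (at j)
    step-sound {Γ , E} (byIntroL i i∈Γ l) with find l
    ... | l , l∈ , i≡ , prems₁ , prems₂ =
      weaken (transport (λ φ → ⊢ ((φ ∷ formulas Γ) ⇒ decodeSucc E)) (sym i≡)
                (leftI l l∈ (formulas Γ) (decodeSucc E) σ
                  (λ {cl} cl∈ → premise-sound σ cl (All.lookup prems₁ cl∈))
                  (λ Σ′∈ → weaken (ih (All.lookup prems₂ Σ′∈)) (formulas-adjoin Γ _))))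
             λ { (here refl) → ∈-formulas⁺ i∈Γ ; (there φ∈) → φ∈ }
      where σ = matchingSubst (at i)

  provable-sound : ∀ {u} → Provable u → Sound u
  provable-sound = μ-induction Sound (λ ih → step-sound ih)

  provable-mono : ∀ {Γ Δ E} → Γ ⊆ₛ Δ → Provable (Γ , E) → Provable (Δ , E)
  provable-mono {Γ} Γ⊆Δ ⊢Γ = μ-closed (byWeakenL Γ Γ⊆Δ ⊢Γ)

  provable-axiom : ∀ {ψ w} → ψ ∈ F → ψ ∈ formulas w → Provable (w , encodeSucc (just ψ))
  provable-axiom {ψ} {w} ψ∈F ψ∈w with encodeSucc-∈ ψ∈F
  ... | j , eq , j≡ rewrite eq = μ-closed (byAxiom (transport (_∈ formulas w) (sym j≡) ψ∈w))

  Saturated : Maybe Index → Antecedent → Set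
  Saturated E w = ¬ Provable (w , E) × (∀ i → i ∈ₛ w ⊎ Provable (⁅ i ⁆ ∪ w , E))

  module Lindenbaum (E : Maybe Index) where

    extend : Index → Antecedent → Antecedent
    extend i Γ with provable? (⁅ i ⁆ ∪ Γ , E)
    ... | yes _ = Γ
    ... | no  _ = ⁅ i ⁆ ∪ Γ

    ⊆-extend : ∀ i Γ → Γ ⊆ₛ extend i Γ
    ⊆-extend i Γ with provable? (⁅ i ⁆ ∪ Γ , E)
    ... | yes _ = id
    ... | no  _ = q⊆p∪q ⁅ i ⁆ Γ

    extend-unprovable : ∀ i {Γ} → ¬ Provable (Γ , E) → ¬ Provable (extend i Γ , E)
    extend-unprovable i {Γ} ⊬Γ with provable? (⁅ i ⁆ ∪ Γ , E)
    ... | yes _   = ⊬Γ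
    ... | no ⊬iΓ  = ⊬iΓ

    extend-decides : ∀ i Γ {Δ} → extend i Γ ⊆ₛ Δ → i ∈ₛ Δ ⊎ Provable (⁅ i ⁆ ∪ Δ , E)
    extend-decides i Γ ext⊆Δ with provable? (⁅ i ⁆ ∪ Γ , E)
    ... | yes ⊢iΓ = inj₂ (provable-mono (insert-mono i ext⊆Δ) ⊢iΓ)
    ... | no  _   = inj₁ (ext⊆Δ (x∈p∪q⁺ (inj₁ (x∈⁅x⁆ i))))

    saturate : List Index → Antecedent → Antecedent
    saturate []       Γ = Γ
    saturate (i ∷ is) Γ = saturate is (extend i Γ)

    ⊆-saturate : ∀ is Γ → Γ ⊆ₛ saturate is Γ
    ⊆-saturate []       Γ = id
    ⊆-saturate (i ∷ is) Γ = ⊆-saturate is (extend i Γ) ∘ ⊆-extend i Γ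

    saturate-unprovable : ∀ is {Γ} → ¬ Provable (Γ , E) → ¬ Provable (saturate is Γ , E)
    saturate-unprovable []       ⊬Γ = ⊬Γ
    saturate-unprovable (i ∷ is) ⊬Γ = saturate-unprovable is (extend-unprovable i ⊬Γ)

    saturate-decides : ∀ is Γ {i} → i ∈ is →
                       i ∈ₛ saturate is Γ ⊎ Provable (⁅ i ⁆ ∪ saturate is Γ , E)
    saturate-decides (i ∷ is) Γ (here refl) = extend-decides i Γ (⊆-saturate is (extend i Γ))
    saturate-decides (j ∷ is) Γ (there i∈) = saturate-decides is (extend j Γ) i∈

  lindenbaum : ∀ {Γ E} → ¬ Provable (Γ , E) → ∃[ w ] Γ ⊆ₛ w × Saturated E w
  lindenbaum {Γ} {E} ⊬Γ =
    saturate (allFin _) Γ , ⊆-saturate (allFin _) Γ ,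
    saturate-unprovable (allFin _) ⊬Γ , λ i → saturate-decides (allFin _) Γ (∈-allFin i)
    where open Lindenbaum E

  saturated-closed : ∀ {E w i} → Saturated E w → Provable (w , just i) → i ∈ₛ w
  saturated-closed {i = i} (⊬w , decides) ⊢i with decides i
  ... | inj₁ i∈w = i∈w
  ... | inj₂ ⊢iw = ⊥-elim (⊬w (μ-closed (byCut i ⊢i ⊢iw)))

  saturated-consistent : ∀ {E w} → Saturated E w → ¬ Provable (w , nothing)
  saturated-consistent {nothing} (⊬w , _) ⊢w = ⊬w ⊢w
  saturated-consistent {just j}  (⊬w , _) ⊢w = ⊬w (μ-closed (byWeakenR ⊢w))


module Countermodel (L : Language) (G : CanonicalSystem L) (coherent : Coherent L G)
                    (S : List (Sequent L)) (F : List (Formula L))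
                    (F-closed : Syntax.SubformulaClosed L F) (S-over-F : All (Syntax.SequentOver L F) S) where
  open Language L
  open CanonicalSystem G
  open Syntax L
  open AnalyticCalculus L G S F
  open import Data.List.Membership.DecPropositional _≟_ using (_∈?_)

  IsWorld : Antecedent → Set
  IsWorld w = ∃[ E ] Saturated E w

  isWorld? : ∀ w → Dec (IsWorld w)
  isWorld? w = ∃-enumerable? (optionsOf (allFin _)) (∈-optionsOf ∈-allFin)
                 (λ E → ¬? (provable? (w , E)) ×-dec all? (λ i → (i ∈ₛ? w) ⊎-dec provable? _))

  □ : (Antecedent → Set) → Antecedent → Set
  □ P w = ∀ w′ → IsWorld w′ → w ⊆ₛ w′ → P w′

  □? : ∀ {P} → (∀ w → Dec (P w)) → ∀ w → Dec (□ P w)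
  □? P? w = ∀-enumerable? (subsets _) ∈-subsets (λ w′ → isWorld? w′ →-dec (w ⊆ₛ? w′) →-dec P? w′)

  -- The arguments enter through their truth values vs w′, so that val below is structurally
  -- recursive; lookupOr pads them with junk beyond the arity.
  Forced : ∀ {n} → Conn → (Antecedent → Vec Bool n) → Antecedent → Set
  Forced c vs w =
    Any (λ r → RightRule.conn r ≡ c ×
               All (λ cl → □ (λ w′ → satisfies L (lookupOr false (vs w′)) cl) w) (RightRule.premises r))
        rightRules

  forced? : ∀ {n} c (vs : Antecedent → Vec Bool n) w → Dec (Forced c vs w)
  forced? c vs w =
    Any.any? (λ r → (RightRule.conn r ≟C c) ×-dec
                    All.all? (λ cl → □? (λ w′ → satisfies? (lookupOr false (vs w′)) cl) w) _)
             rightRules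

  mutual
    val : Formula L → Antecedent → Bool
    val φ w with φ ∈? F
    ... | yes _ = does (φ ∈? formulas w)
    ... | no  _ = valOutside φ w

    valOutside : Formula L → Antecedent → Bool
    valOutside (atom _)   w = false
    valOutside (app c φs) w = does (forced? c (vals φs) w)

    vals : ∀ {n} → Vec (Formula L) n → Antecedent → Vec Bool n
    vals []       w = []
    vals (φ ∷ φs) w = val φ w ∷ vals φs w

  Holds : Formula L → Antecedent → Set
  Holds φ w = val φ w ≡ true

  atWorld : Substitution L → Antecedent → Assignment L
  atWorld σ w m = val (σ m) w

  argumentsAt : ∀ n → Substitution L → Antecedent → Assignment L
  argumentsAt n σ w = lookupOr false (vals (arguments {n} σ) w)

  holds-inside⁺ : ∀ {φ w} → φ ∈ F → φ ∈ formulas w → Holds φ w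
  holds-inside⁺ {φ} {w} φ∈F φ∈w with φ ∈? F
  ... | yes _  = dec-true (φ ∈? formulas w) φ∈w
  ... | no φ∉F = ⊥-elim (φ∉F φ∈F)

  holds-inside⁻ : ∀ {φ w} → φ ∈ F → Holds φ w → φ ∈ formulas w
  holds-inside⁻ {φ} {w} φ∈F holds with φ ∈? F
  ... | no φ∉F = ⊥-elim (φ∉F φ∈F)
  ... | yes _ with φ ∈? formulas w
  ...   | yes φ∈w = φ∈w
  ...   | no  _   with () ← holds

  val-outside : ∀ {φ w} → ¬ φ ∈ F → val φ w ≡ valOutside φ w
  val-outside {φ} φ∉F with φ ∈? F
  ... | yes φ∈F = ⊥-elim (φ∉F φ∈F)
  ... | no  _   = refl

  forced-mono : ∀ {n c} {vs : Antecedent → Vec Bool n} {w w′} → w ⊆ₛ w′ → Forced c vs w → Forced c vs w′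
  forced-mono w⊆w′ = Any.map λ (c≡ , prems) →
    c≡ , All.map (λ □sat w″ world w′⊆w″ → □sat w″ world (λ x∈ → w′⊆w″ (w⊆w′ x∈))) prems

  holds-mono : ∀ φ {w w′} → w ⊆ₛ w′ → Holds φ w → Holds φ w′
  holds-mono φ {w} {w′} w⊆w′ holds = by-cases (φ ∈? F)
    where
      valOutside-mono : ∀ φ → valOutside φ w ≡ true → valOutside φ w′ ≡ true
      valOutside-mono (atom _)   ()
      valOutside-mono (app c φs) forced =
        dec-true (forced? c (vals φs) w′)
                 (forced-mono {vs = vals φs} w⊆w′ (does≡true⇒ (forced? c (vals φs) w) forced))

      by-cases : Dec (φ ∈ F) → Holds φ w′
      by-cases (yes φ∈F) = holds-inside⁺ φ∈F (formulas-mono w⊆w′ (holds-inside⁻ φ∈F holds))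
      by-cases (no  φ∉F) =
        trans (val-outside φ∉F) (valOutside-mono φ (trans (sym (val-outside φ∉F)) holds))

  lookup-vals : ∀ {n} (φs : Vec (Formula L) n) w i → lookup (vals φs w) i ≡ val (lookup φs i) w
  lookup-vals (φ ∷ φs) w zero    = refl
  lookup-vals (φ ∷ φs) w (suc i) = lookup-vals φs w i

  argumentsAt-atWorld : ∀ n σ w → argumentsAt n σ w ≗[ n ] atWorld σ w
  argumentsAt-atWorld n σ w i =
    trans (lookupOr-toℕ false (vals (arguments σ) w) i)
          (trans (lookup-vals (arguments σ) w i) (cong (λ φ → val φ w) (lookup-arguments σ i)))

  instance-arguments-∈F : ∀ {σ c} → subst L σ (schema L c) ∈ F → ∀ (i : Fin (arity c)) → σ (toℕ i) ∈ F
  instance-arguments-∈F {σ} φ∈F i = transport (_∈ F) (lookup-arguments σ i) (F-closed φ∈F i)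

  matching-instance : ∀ {j σ c} → at j ≡ subst L σ (schema L c) →
                      IsInstance j c × matchingSubst (at j) ≗[ arity c ] σ
  matching-instance {j} {σ} {c} j≡ = trans j≡ (subst-schema-cong c (sym ∘ agree)) , agree
    where
      agree : matchingSubst (at j) ≗[ arity c ] σ
      agree i = trans (cong (λ φ → matchingSubst φ (toℕ i)) j≡) (matchingSubst-instance σ c i)

  -- Were the premise unprovable, Lindenbaum would give a world above w refuting it.
  premise-provable : ∀ {n} σ τ → τ ≗[ n ] σ → (∀ (i : Fin n) → σ (toℕ i) ∈ F) → ∀ w (cl : Clause L n) →
                     □ (λ w′ → satisfies L (atWorld σ w′) cl) w → Premise μ w τ cl
  premise-provable σ τ τ≗σ σ∈F w (Π , E) □sat
    rewrite Listₚ.map-cong τ≗σ Π | Maybeₚ.map-cong τ≗σ E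
    with provable? (adjoin w (inst L σ Π) , encodeSucc (instE L σ E))
  ... | yes ⊢premise = ⊢premise
  ... | no  ⊬premise with lindenbaum ⊬premise
  ...   | w′ , ⊆w′ , saturated@(⊬w′ , _)
          with □sat w′ (_ , saturated) (λ x∈ → ⊆w′ (⊆-adjoin w (inst L σ Π) x∈))
  ...     | inj₁ falsified =
              let p , p∈Π , p-false = find falsified
                  σp∈w′ = ∈-formulas-indices (σ∈F p) (∈-map⁺ _ p∈Π)
                                             (λ x∈ → ⊆w′ (q⊆p∪q w (indices (inst L σ Π)) x∈))
              in ⊥-elim (true≢false (holds-inside⁺ (σ∈F p) σp∈w′) p-false)
  ...     | inj₂ (q , refl , q-holds) =
              ⊥-elim (⊬w′ (provable-axiom (σ∈F q) (holds-inside⁻ (σ∈F q) q-holds)))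

  negative-premise-provable : ∀ {n E₀ w} σ τ → τ ≗[ n ] σ → (∀ (i : Fin n) → σ (toℕ i) ∈ F) →
                              Saturated E₀ w → (Σ′ : List (Fin n)) → satisfiesNeg L (atWorld σ w) Σ′ →
                              Provable (adjoin w (inst L τ Σ′) , E₀)
  negative-premise-provable σ τ τ≗σ σ∈F (_ , decides) Σ′ (inj₂ (_ , () , _))
  negative-premise-provable {w = w} σ τ τ≗σ σ∈F (_ , decides) Σ′ (inj₁ falsified)
    rewrite Listₚ.map-cong τ≗σ Σ′ with find falsified
  ... | p , p∈Σ′ , p-false with decides (Any.index (σ∈F p))
  ...   | inj₁ j∈w = ⊥-elim (true≢false (holds-inside⁺ (σ∈F p) σp∈w) p-false)
    where σp∈w = transport (_∈ formulas w) (sym (lookup-index (σ∈F p))) (∈-formulas⁺ j∈w)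
  ...   | inj₂ ⊢jw = provable-mono (insert-⊆-adjoin w σp∈Σ′) ⊢jw
    where σp∈Σ′ = transport (_∈ inst L σ Σ′) (lookup-index (σ∈F p)) (∈-map⁺ _ p∈Σ′)

  rightRule-valid : ∀ {r} → r ∈ rightRules → ∀ σ w → IsWorld w →
                    All (λ cl → □ (λ w′ → satisfies L (atWorld σ w′) cl) w) (RightRule.premises r) →
                    Holds (subst L σ (schema L (RightRule.conn r))) w
  rightRule-valid {r} r∈ σ w (_ , saturated) prems = by-cases (φ ∈? F)
    where
      c = RightRule.conn r
      φ = subst L σ (schema L c)

      by-cases : Dec (φ ∈ F) → Holds φ w
      by-cases (yes φ∈F) = holds-inside⁺ φ∈F (transport (_∈ formulas w) (sym φ≡) (∈-formulas⁺ j∈w))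
        where
          φ≡ = lookup-index φ∈F
          j = Any.index φ∈F
          isInstance = proj₁ (matching-instance {j} (sym φ≡))
          agree      = proj₂ (matching-instance {j} (sym φ≡))
          args∈F     = instance-arguments-∈F φ∈F
          ⊢j : Provable (w , just j)
          ⊢j = μ-closed (byIntroR (lose r∈ (isInstance ,
                 All.map (λ {cl} → premise-provable σ (matchingSubst (at j)) agree args∈F w cl) prems)))
          j∈w : j ∈ₛ w
          j∈w = saturated-closed saturated ⊢j
      by-cases (no φ∉F) =
        trans (val-outside φ∉F) (dec-true (forced? c (vals (arguments {arity c} σ)) w) forced)
        where
          forced : Forced c (vals (arguments {arity c} σ)) w
          forced = lose r∈ (refl , All.map (λ {cl} □sat w′ world w⊆w′ →
                     satisfies-cong {u = atWorld σ w′} {v = argumentsAt (arity c) σ w′}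
                                    (sym ∘ argumentsAt-atWorld (arity c) σ w′) cl
                                    (□sat w′ world (λ x∈ → w⊆w′ x∈)))
                     prems)

  leftRule-refuted : ∀ {l} → l ∈ leftRules → ∀ σ w → IsWorld w →
                     Holds (subst L σ (schema L (LeftRule.conn l))) w →
                     All (λ cl → □ (λ w′ → satisfies L (atWorld σ w′) cl) w) (LeftRule.prem1 l) →
                     All (satisfiesNeg L (atWorld σ w)) (LeftRule.prem2 l) → ⊥
  leftRule-refuted {l} l∈ σ w world@(E₀ , saturated@(⊬w , _)) holds prems₁ prems₂ = by-cases (φ ∈? F)
    where
      c = LeftRule.conn l
      φ = subst L σ (schema L c)

      by-cases : Dec (φ ∈ F) → ⊥
      by-cases (yes φ∈F) with ∈-formulas⁻ (holds-inside⁻ φ∈F holds)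
      ... | i , i∈w , φ≡ = ⊬w (μ-closed (byIntroL i i∈w (lose l∈ (isInstance ,
              All.map (λ {cl} → premise-provable σ τ agree args∈F w cl) prems₁ ,
              All.map (λ {Σ′} → negative-premise-provable σ τ agree args∈F saturated Σ′) prems₂))))
        where
          isInstance = proj₁ (matching-instance {i} (sym φ≡))
          agree      = proj₂ (matching-instance {i} (sym φ≡))
          τ = matchingSubst (at i)
          args∈F = instance-arguments-∈F φ∈F
      by-cases (no φ∉F) with find (does≡true⇒ (forced? c (vals (arguments {arity c} σ)) w)
                                               (trans (sym (val-outside φ∉F)) holds))
      ... | r , r∈ , r≡ , prems =
        coherent l l∈ r r∈ (sym r≡) (atWorld σ w ,
          All.map (λ □sat → □sat w world (λ x∈ → x∈)) prems₁ , prems₂ ,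
          All.map (λ {cl} □sat → satisfies-cong {u = argumentsAt (arity c) σ w} {v = atWorld σ w} agree cl
                                                (□sat w world (λ x∈ → x∈)))
                  prems)
        where
          agree : argumentsAt (arity c) σ w ≗[ arity (RightRule.conn r) ] atWorld σ w
          agree = transport (λ n → argumentsAt (arity c) σ w ≗[ n ] atWorld σ w)
                            (cong arity (sym r≡)) (argumentsAt-atWorld (arity c) σ w)

  Valid : Sequent L → Set
  Valid (Γ ⇒ E) = ∀ w → IsWorld w → All (λ φ → Holds φ w) Γ → Anyᴹ (λ φ → Holds φ w) E

  instance-holds-or-falsified : ∀ {n} σ w (Π : List (Fin n)) →
                                All (λ φ → Holds φ w) (inst L σ Π) ⊎ Any (λ p → atWorld σ w (toℕ p) ≡ false) Π
  instance-holds-or-falsified σ w Π with All.all? (λ φ → val φ w ≟ᵇ true) (inst L σ Π)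
  ... | yes all-hold = inj₁ all-hold
  ... | no ¬all-hold = inj₂ (map⁻ (Any.map ¬-not (¬All⇒Any¬ (λ φ → val φ w ≟ᵇ true) _ ¬all-hold)))

  premise-satisfied : ∀ {n} σ Γ (cl : Clause L n) → Valid ((Γ ++ inst L σ (proj₁ cl)) ⇒ instE L σ (proj₂ cl)) →
                      ∀ w → IsWorld w → All (λ φ → Holds φ w) Γ → satisfies L (atWorld σ w) cl
  premise-satisfied σ Γ (Π , E) valid w world Γ-holds with instance-holds-or-falsified σ w Π
  ... | inj₂ falsified = inj₁ falsified
  ... | inj₁ Π-holds with E | valid w world (++⁺ Γ-holds Π-holds)
  ...   | just q | Anyᴹ.just q-holds = inj₂ (q , refl , q-holds)

  negative-premise-satisfied : ∀ {n} σ Γ (Σ′ : List (Fin n)) E → Valid ((Γ ++ inst L σ Σ′) ⇒ E) →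
                               ∀ w → IsWorld w → All (λ φ → Holds φ w) Γ → ¬ Anyᴹ (λ φ → Holds φ w) E →
                               satisfiesNeg L (atWorld σ w) Σ′
  negative-premise-satisfied σ Γ Σ′ E valid w world Γ-holds ¬E-holds with instance-holds-or-falsified σ w Σ′
  ... | inj₁ Σ′-holds  = ⊥-elim (¬E-holds (valid w world (++⁺ Γ-holds Σ′-holds)))
  ... | inj₂ falsified = inj₁ falsified

  saturated-succedent : ∀ {E₀ w E} → Saturated E₀ w → Allᴹ (_∈ F) E → Provable (w , encodeSucc E) →
                        Anyᴹ (λ ψ → Holds ψ w) E
  saturated-succedent saturated Allᴹ.nothing ⊢w = ⊥-elim (saturated-consistent saturated ⊢w)
  saturated-succedent {w = w} saturated (Allᴹ.just ψ∈F) ⊢w with encodeSucc-∈ ψ∈F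
  ... | j , eq , j≡ rewrite eq =
    Anyᴹ.just (holds-inside⁺ ψ∈F (transport (_∈ formulas w) j≡ (∈-formulas⁺ (saturated-closed saturated ⊢w))))

  hypothesis-valid : ∀ {Γ E} → (Γ ⇒ E) ∈ S → Valid (Γ ⇒ E)
  hypothesis-valid {Γ} {E} s∈S w (_ , saturated) Γ-holds =
    saturated-succedent saturated E⊆F
      (μ-closed (byHypothesis (lose s∈S (Γ⊆w , sym (decodeSucc-encodeSucc E⊆F)))))
    where
      Γ⊆F = proj₁ (All.lookup S-over-F s∈S)
      E⊆F = proj₂ (All.lookup S-over-F s∈S)
      Γ⊆w : Γ ⊆ formulas w
      Γ⊆w φ∈Γ = holds-inside⁻ (Γ⊆F φ∈Γ) (All.lookup Γ-holds φ∈Γ)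

  valid : ∀ {s} → ⊢ s → Valid s
  valid (hyp s∈S) = hypothesis-valid s∈S
  valid (ax φ) w world (φ-holds ∷ []) = Anyᴹ.just φ-holds
  valid (setEq Γ≈Δ ⊢Γ) w world Δ-holds =
    valid ⊢Γ w world (All.tabulate (λ φ∈Γ → All.lookup Δ-holds (Equivalence.to (Γ≈Δ _) φ∈Γ)))
  valid (weakL {Γ} Δ ⊢Γ) w world holds = valid ⊢Γ w world (++⁻ˡ Γ holds)
  valid (weakR ψ ⊢Γ) w world holds with () ← valid ⊢Γ w world holds
  valid (cut {Γ} ⊢φ ⊢φΔ) w world holds with valid ⊢φ w world (++⁻ˡ Γ holds)
  ... | Anyᴹ.just φ-holds = valid ⊢φΔ w world (φ-holds ∷ ++⁻ʳ Γ holds)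
  valid (rightI r r∈ Γ σ ⊢prems) w world Γ-holds =
    Anyᴹ.just (rightRule-valid r∈ σ w world (All.tabulate λ cl∈ w′ world′ w⊆w′ →
      premise-satisfied σ Γ _ (valid (⊢prems cl∈)) w′ world′
                        (All.map (holds-mono _ (λ x∈ → w⊆w′ x∈)) Γ-holds)))
  valid (leftI l l∈ Γ E σ ⊢prems₁ ⊢prems₂) w world (φ-holds ∷ Γ-holds)
    with Anyᴹ.dec (λ ψ → val ψ w ≟ᵇ true) E
  ... | yes E-holds = E-holds
  ... | no ¬E-holds = ⊥-elim (leftRule-refuted l∈ σ w world φ-holds
          (All.tabulate λ cl∈ w′ world′ w⊆w′ →
            premise-satisfied σ Γ _ (valid (⊢prems₁ cl∈)) w′ world′
                              (All.map (holds-mono _ (λ x∈ → w⊆w′ x∈)) Γ-holds))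
          (All.tabulate λ Σ′∈ →
            negative-premise-satisfied σ Γ _ E (valid (⊢prems₂ Σ′∈)) w world Γ-holds ¬E-holds))

  decide : ∀ s → SequentOver F s → Dec (⊢ s)
  decide (Γ ⇒ E) (Γ⊆F , E⊆F) with provable? (indices Γ , encodeSucc E)
  ... | yes ⊢code = yes (weaken ⊢Γ (formulas-indices Γ))
    where
      ⊢Γ = transport (λ E′ → ⊢ (formulas (indices Γ) ⇒ E′)) (decodeSucc-encodeSucc E⊆F) (provable-sound ⊢code)
  ... | no ⊬code with lindenbaum ⊬code
  ...   | w , Γ⊆w , saturated@(⊬w , _) =
          no λ ⊢s → ⊬w (succedent-provable E⊆F (valid ⊢s w (_ , saturated) Γ-holds))
    where
      Γ-holds : All (λ φ → Holds φ w) Γ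
      Γ-holds = All.tabulate λ φ∈Γ → holds-inside⁺ (Γ⊆F φ∈Γ) (∈-formulas-indices (Γ⊆F φ∈Γ) φ∈Γ Γ⊆w)

      succedent-provable : ∀ {E} → Allᴹ (_∈ F) E → Anyᴹ (λ ψ → Holds ψ w) E → Provable (w , encodeSucc E)
      succedent-provable (Allᴹ.just ψ∈F) (Anyᴹ.just ψ-holds) = provable-axiom ψ∈F (holds-inside⁻ ψ∈F ψ-holds)

theorem7p4 : (L : Language) (G : CanonicalSystem L) → Coherent L G → StronglyDecidable L G
theorem7p4 L G coherent S s = decide s (sequentOver-closure {ss = s ∷ S} (here refl))
  where
    open Syntax L
    roots = concatMap sequentFormulas (s ∷ S)
    open Countermodel L G coherent S (subformulaClosure roots) (subformulaClosure-closed roots)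
                      (All.tabulate λ s′∈S → sequentOver-closure {ss = s ∷ S} (there s′∈S))
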